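{- Let $n$, $a$, $q$ be integers with $n=qa+a-1$ and $3\le q<a-1$, and suppose $a=kq+1+s$ with integers $k\ge 1$ and $0\le s\le q-1$. Then (1) if $s=0$, $\beta_b(\overrightarrow{C}(n;1,a))\ge (a+k)(q-1)$; (2) if $s=1$, $\beta_b(\overrightarrow{C}(n;1,a))\ge (a+k-1)(q-1)+1$; (3) if $s\ge 2$, $\beta_b(\overrightarrow{C}(n;1,a))\ge (a+k-s)(q-1)+(s-1)(s+1)$.
   Context: The oriented circulant graph $\overrightarrow{C}(n;1,a)$ has vertex set $\{v_0,\dots,v_{n-1}\}$ and arcs $v_iv_{i+1}$, $v_iv_{i+a}$, subscripts modulo $n$. $d(u,v)$ is the length of a shortest directed path from $u$ to $v$; $e(v)=\max_u d(v,u)$; $\mathrm{diam}$ is the maximum eccentricity. An independent broadcast is $f:V\to\{0,\dots,\mathrm{diam}\}$ with $f(v)\le e(v)$ for all $v$ and $d(u,v)>f(u)$ for all distinct $u,v$ with $f(u),f(v)>0$; its cost is $\sigma(f)=\sum_v f(v)$, and $\beta_b$ is the maximum cost of an independent broadcast. -}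

module Defs where

open import Data.Nat using (ℕ; zero; suc; _+_; _*_; _∸_; _≤_; _<_; _⊔_)
open import Data.Nat.DivMod using (_mod_)
open import Data.Fin using (Fin; toℕ; _≟_)
open import Data.List using (List; map; foldr; allFin)
open import Data.Nat.ListAction using (sum)
open import Data.Bool using (Bool; true; false; _∨_; if_then_else_)
open import Relation.Nullary.Decidable using (⌊_⌋)
open import Relation.Binary.PropositionalEquality using (_≡_)
open import Relation.Nullary using (¬_)

-- Oriented circulant graph C(n;1,a): vertices Fin n (v_i ↦ i),
-- arcs v_i → v_{i+1 mod n} and v_i → v_{i+a mod n}.
shift : ∀ {n} → ℕ → Fin n → Fin n
shift {suc m} c i = (toℕ i + c) mod (suc m)

reach : ∀ {n} → ℕ → ℕ → Fin n → Fin n → Bool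
reach a zero    u v = ⌊ u ≟ v ⌋
reach a (suc L) u v = reach a L (shift 1 u) v ∨ reach a L (shift a u) v

firstReach : ∀ {n} → ℕ → ℕ → ℕ → Fin n → Fin n → ℕ
firstReach a zero       i u v = i
firstReach a (suc fuel) i u v =
  if reach a i u v then i else firstReach a fuel (suc i) u v

-- d(u,v): length of a shortest directed path from u to v.
-- (v is always reachable from u within n-1 steps via the arcs v_i v_{i+1},
--  so searching L = 0 .. n-1 always finds the minimum.)
dist : ∀ {n} → ℕ → Fin n → Fin n → ℕ
dist {n} a u v = firstReach a n 0 u v

maxList : List ℕ → ℕ
maxList = foldr _⊔_ 0

ecc : ∀ {n} → ℕ → Fin n → ℕ
ecc {n} a v = maxList (map (dist a v) (allFin n))

diam : ℕ → ℕ → ℕ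
diam n a = maxList (map (ecc {n} a) (allFin n))

cost : ∀ {n} → (Fin n → ℕ) → ℕ
cost {n} f = sum (map f (allFin n))

record IndependentBroadcast (n a : ℕ) (f : Fin n → ℕ) : Set where
  field
    le-diam : ∀ v → f v ≤ diam n a
    le-ecc  : ∀ v → f v ≤ ecc a v
    indep   : ∀ u v → ¬ (u ≡ v) → 0 < f u → 0 < f v → f u < dist a u v

βb≥ : ℕ → ℕ → ℕ → Set
βb≥ n a b = Σ (Fin n → ℕ) λ f → IndependentBroadcast n a f × (b ≤ cost f)
  where open import Data.Product using (Σ; _×_)

{-# OPTIONS --safe #-}
module Submission where

open import Defs
open import Data.Nat using (ℕ; _+_; _*_; _∸_; _≤_; _<_)
open import Data.Product using (_×_)
open import Relation.Binary.PropositionalEquality using (_≡_)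

open import Data.Bool using (true; false)
open import Data.Bool.Properties using (¬-not)
open import Data.Fin using (Fin; toℕ) renaming (_≟_ to _≟ᶠ_)
open import Data.Fin.Properties using (toℕ-fromℕ<; toℕ<n; toℕ-injective)
open import Data.List using (List; _∷_; tabulate)
open import Data.List.Membership.Propositional using (_∈_)
open import Data.List.Membership.Propositional.Properties using (∈-map⁺; ∈-allFin)
open import Data.List.Properties using (map-tabulate)
open import Data.List.Relation.Unary.Any using (here; there)
open import Data.Nat using (zero; suc; z≤n; s≤s; s≤s⁻¹; z<s; s<s; NonZero)
open import Data.Nat.DivMod
open import Data.Nat.Divisibility using (divides-refl)
open import Data.Nat.ListAction using (sum)
open import Data.Nat.Properties
open import Data.Nat.Tactic.RingSolver using (solve-∀)
open import Data.Product using (∃₂; _,_; proj₁)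
open import Data.Sum using (_⊎_; inj₁; inj₂)
open import Function using (_∘_)
open import Relation.Binary.PropositionalEquality
  using (_≢_; refl; sym; trans; cong; cong₂; subst; subst₂; module ≡-Reasoning)
open import Relation.Nullary using (¬_; yes; no)
open import Relation.Nullary.Negation using (contradiction)

-- Write a = a′ + 1, so that n = q·a + a′, and split s = r + s′. Vertex v_i with i = t·a + c,
-- c < a, gets the level t + c. A walk of length L < a from level l ends at level l + L, less a′
-- if its short steps carry past a multiple of a and less q if it wraps around past v_{n-1}.
-- The broadcast gives V₀ to v_0 and, to every vertex of level r + m·q, the value q − 1 when
-- 1 ≤ m ≤ k and w when m = k + 1. Positive levels other than 0 are ≡ r (mod q), so a walk of
-- length L < q joins two of them only across a carry; that forces L ≥ s′ and a start at level
-- r + (k + 1)·q, whose value w < s′ is too small. Level 0 cannot reach the others since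
-- V₀ < q + r. Row t (the indices t·a ≤ i < (t + 1)·a) is a window of consecutive levels
-- containing r + q, …, r + k·q, and r + (k + 1)·q as well in the last s′ + 1 rows, so the cost
-- is at least V₀ + (q + 1)·k·(q − 1) + (s′ + 1)·w. Every eccentricity is at least q, so all values
-- are admissible. The three cases take (r, s′, V₀, w) = (0, 0, q − 1, 0), (1, 0, q, 0) and
-- (0, s, q − 1, s − 1).

Σ< : ℕ → (ℕ → ℕ) → ℕ
Σ< zero    g = 0
Σ< (suc n) g = g 0 + Σ< n (g ∘ suc)

syntax Σ< n (λ i → e) = ∑[ i < n ] e

cost-toℕ : ∀ n (g : ℕ → ℕ) → cost {n} (g ∘ toℕ) ≡ Σ< n g
cost-toℕ n g = trans (cong sum (map-tabulate {n = n} (λ i → i) (g ∘ toℕ))) (sum-tabulate n g)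
  where
  sum-tabulate : ∀ n (g : ℕ → ℕ) → sum (tabulate {n = n} (g ∘ toℕ)) ≡ Σ< n g
  sum-tabulate zero    g = refl
  sum-tabulate (suc n) g = cong (g 0 +_) (sum-tabulate n (g ∘ suc))

Σ<-+ : ∀ m n g → Σ< (m + n) g ≡ Σ< m g + ∑[ i < n ] g (m + i)
Σ<-+ zero    n g = refl
Σ<-+ (suc m) n g = trans (cong (g 0 +_) (Σ<-+ m n (g ∘ suc))) (sym (+-assoc (g 0) _ _))

Σ<-suc : ∀ n g → Σ< (suc n) g ≡ Σ< n g + g n
Σ<-suc zero    g = +-identityʳ (g 0)
Σ<-suc (suc n) g = trans (cong (g 0 +_) (Σ<-suc n (g ∘ suc))) (sym (+-assoc (g 0) _ _))

Σ<-cong : ∀ n {g h} → (∀ i → i < n → g i ≡ h i) → Σ< n g ≡ Σ< n h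
Σ<-cong zero    g≡h = refl
Σ<-cong (suc n) g≡h = cong₂ _+_ (g≡h 0 z<s) (Σ<-cong n (λ i i<n → g≡h (suc i) (s<s i<n)))

Σ<-const-≤ : ∀ n {C g} → (∀ i → i < n → C ≤ g i) → n * C ≤ Σ< n g
Σ<-const-≤ zero    C≤g = z≤n
Σ<-const-≤ (suc n) C≤g = +-mono-≤ (C≤g 0 z<s) (Σ<-const-≤ n (λ i i<n → C≤g (suc i) (s<s i<n)))

Σ<-monoˡ-≤ : ∀ {m n} g → m ≤ n → Σ< m g ≤ Σ< n g
Σ<-monoˡ-≤ {m} g m≤n with m≤n⇒∃[o]m+o≡n m≤n
... | o , refl = subst (Σ< m g ≤_) (sym (Σ<-+ m o g)) (m≤m+n (Σ< m g) (∑[ i < o ] g (m + i)))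

Σ<-blocks : ∀ t a g → Σ< (t * a) g ≡ ∑[ j < t ] ∑[ c < a ] g (j * a + c)
Σ<-blocks zero    a g = refl
Σ<-blocks (suc t) a g = trans (Σ<-+ a (t * a) g) (cong (Σ< a g +_) (trans (Σ<-blocks t a (λ i → g (a + i)))
  (Σ<-cong t (λ j _ → Σ<-cong a (λ c _ → cong g (sym (+-assoc a (j * a) c)))))))

Σ<-sample : ∀ d j g → ∑[ m < suc j ] g (m * suc d) ≤ Σ< (suc (j * suc d)) g
Σ<-sample d zero    g = ≤-refl
Σ<-sample d (suc j) g = +-monoʳ-≤ (g 0) (begin
  ∑[ m < suc j ] g (suc d + m * suc d)                     ≤⟨ Σ<-sample d j (λ i → g (suc d + i)) ⟩
  ∑[ i < suc (j * suc d) ] g (suc (d + i))                 ≤⟨ m≤n+m _ (Σ< d (g ∘ suc)) ⟩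
  Σ< d (g ∘ suc) + ∑[ i < suc (j * suc d) ] g (suc (d + i)) ≡⟨ Σ<-+ d (suc (j * suc d)) (g ∘ suc) ⟨
  Σ< (d + suc (j * suc d)) (g ∘ suc)                       ≡⟨ cong (λ l → Σ< l (g ∘ suc)) (+-suc d (j * suc d)) ⟩
  Σ< (suc (d + j * suc d)) (g ∘ suc)                       ∎)
  where open ≤-Reasoning

Σ<-window : ∀ δ d j {len} g → δ + j * suc d < len → ∑[ m < suc j ] g (δ + m * suc d) ≤ Σ< len g
Σ<-window δ d j {len} g δ+jd<len = begin
  ∑[ m < suc j ] g (δ + m * suc d)           ≤⟨ Σ<-sample d j (λ i → g (δ + i)) ⟩
  ∑[ i < suc (j * suc d) ] g (δ + i)         ≤⟨ m≤n+m _ (Σ< δ g) ⟩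
  Σ< δ g + ∑[ i < suc (j * suc d) ] g (δ + i) ≡⟨ Σ<-+ δ (suc (j * suc d)) g ⟨
  Σ< (δ + suc (j * suc d)) g                 ≤⟨ Σ<-monoˡ-≤ g (subst (_≤ len) (sym (+-suc δ _)) δ+jd<len) ⟩
  Σ< len g                                   ∎
  where open ≤-Reasoning

m<n+n⇒m≡m%n⊎m≡m%n+n : ∀ {m} n .{{_ : NonZero n}} → m < n + n → m ≡ m % n ⊎ m ≡ m % n + n
m<n+n⇒m≡m%n⊎m≡m%n+n {m} n m<n+n with m <? n
... | yes m<n = inj₁ (sym (m<n⇒m%n≡m m<n))
... | no m≮n  = inj₂ (begin
  m               ≡⟨ m∸n+n≡m n≤m ⟨
  m ∸ n + n       ≡⟨ cong (_+ n) (m<n⇒m%n≡m m∸n<n) ⟨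
  (m ∸ n) % n + n ≡⟨ cong (_+ n) (m≤n⇒[n∸m]%m≡n%m n≤m) ⟩
  m % n + n       ∎)
  where
  open ≡-Reasoning
  n≤m : n ≤ m
  n≤m = ≮⇒≥ m≮n
  m∸n<n : m ∸ n < n
  m∸n<n = subst (m ∸ n <_) (m+n∸n≡m n n) (∸-monoˡ-< m<n+n n≤m)

[m%n+k]%n≡[m+k]%n : ∀ m k n .{{_ : NonZero n}} → (m % n + k) % n ≡ (m + k) % n
[m%n+k]%n≡[m+k]%n m k n = begin
  (m % n + k) % n          ≡⟨ %-distribˡ-+ (m % n) k n ⟩
  (m % n % n + k % n) % n  ≡⟨ cong (λ i → (i + k % n) % n) (m%n%n≡m%n m n) ⟩
  (m % n + k % n) % n      ≡⟨ %-distribˡ-+ m k n ⟨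
  (m + k) % n              ∎
  where open ≡-Reasoning

[m+kn]%n≡m : ∀ {m} k n .{{_ : NonZero n}} → m < n → (m + k * n) % n ≡ m
[m+kn]%n≡m {m} k n m<n = trans ([m+kn]%n≡m%n m k n) (m<n⇒m%n≡m m<n)

[m+kn]/n≡k : ∀ {m} k n .{{_ : NonZero n}} → m < n → (m + k * n) / n ≡ k
[m+kn]/n≡k {m} k n m<n =
  trans (+-distrib-/-∣ʳ m (divides-refl k)) (cong₂ _+_ (m<n⇒m/n≡0 m<n) (m*n/n≡m k n))

m+kn≡o+ln⇒m≡o×k≡l : ∀ {m o} k l n .{{_ : NonZero n}} → m < n → o < n →
  m + k * n ≡ o + l * n → m ≡ o × k ≡ l
m+kn≡o+ln⇒m≡o×k≡l k l n m<n o<n e =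
    trans (sym ([m+kn]%n≡m k n m<n)) (trans (cong (_% n) e) ([m+kn]%n≡m l n o<n))
  , trans (sym ([m+kn]/n≡k k n m<n)) (trans (cong (_/ n) e) ([m+kn]/n≡k l n o<n))

m<n<m+d⇒m%d≢n%d : ∀ {m n} d .{{_ : NonZero d}} → m < n → n < m + d → m % d ≢ n % d
m<n<m+d⇒m%d≢n%d {m} {n} d m<n n<m+d m%d≡n%d =
  <-irrefl refl (<-≤-trans [m/d]<[n/d] (s≤s⁻¹ [n/d]<1+[m/d]))
  where
  ρ = m % d
  m≡ : m ≡ ρ + m / d * d
  m≡ = m≡m%n+[m/n]*n m d
  n≡ : n ≡ ρ + n / d * d
  n≡ = trans (m≡m%n+[m/n]*n n d) (cong (_+ n / d * d) (sym m%d≡n%d))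
  m+d≡ : m + d ≡ ρ + suc (m / d) * d
  m+d≡ = trans (cong (_+ d) m≡) (trans (+-assoc ρ _ d) (cong (ρ +_) (+-comm (m / d * d) d)))
  [m/d]<[n/d] : m / d < n / d
  [m/d]<[n/d] = *-cancelʳ-< d (m / d) (n / d) (+-cancelˡ-< ρ _ _ (subst₂ _<_ m≡ n≡ m<n))
  [n/d]<1+[m/d] : n / d < suc (m / d)
  [n/d]<1+[m/d] = *-cancelʳ-< d (n / d) (suc (m / d)) (+-cancelˡ-< ρ _ _ (subst₂ _<_ n≡ m+d≡ n<m+d))

firstReach-≥ : ∀ {n} a fuel i (u v : Fin n) {m} → (∀ L → i ≤ L → L < m → reach a L u v ≡ false) →
  m ≤ i + fuel → m ≤ firstReach a fuel i u v
firstReach-≥ a zero i u v miss m≤i+0 = subst (_ ≤_) (+-identityʳ i) m≤i+0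
firstReach-≥ a (suc fuel) i u v {m} miss m≤ with reach a i u v in hit
... | true with m ≤? i
...   | yes m≤i = m≤i
...   | no m≰i  = contradiction (trans (sym hit) (miss i ≤-refl (≰⇒> m≰i))) λ ()
firstReach-≥ a (suc fuel) i u v {m} miss m≤ | false =
  firstReach-≥ a fuel (suc i) u v (λ L i<L → miss L (<⇒≤ i<L)) (subst (m ≤_) (+-suc i fuel) m≤)

-- dist only searches the lengths below n, hence the hypothesis m ≤ n.
dist-≥ : ∀ {n} a (u v : Fin n) {m} → m ≤ n → (∀ L → L < m → reach a L u v ≡ false) → m ≤ dist a u v
dist-≥ a u v m≤n miss = firstReach-≥ a _ 0 u v (λ L _ → miss L) m≤n

maxList-≥ : ∀ {xs : List ℕ} {x} → x ∈ xs → x ≤ maxList xs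
maxList-≥ {y ∷ xs} (here refl)  = m≤m⊔n y (maxList xs)
maxList-≥ {y ∷ xs} (there x∈xs) = ≤-trans (maxList-≥ x∈xs) (m≤n⊔m y (maxList xs))

dist≤ecc : ∀ {n} a (v w : Fin n) → dist a v w ≤ ecc a v
dist≤ecc a v w = maxList-≥ (∈-map⁺ (dist a v) (∈-allFin w))

ecc≤diam : ∀ {n} a (v : Fin n) → ecc a v ≤ diam n a
ecc≤diam a v = maxList-≥ (∈-map⁺ (ecc a) (∈-allFin v))

module _ {n′ : ℕ} (a : ℕ) where
  private
    N = suc n′

  Moves : Fin N → Fin N → ℕ → ℕ → Set
  Moves u v x y = (toℕ u + (x * a + y)) % N ≡ toℕ v

  toℕ-shift : ∀ c (u : Fin N) → toℕ (shift c u) ≡ (toℕ u + c) % N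
  toℕ-shift c u = toℕ-fromℕ< (m%n<n (toℕ u + c) N)

  shift-hits : ∀ c (u v : Fin N) X → (toℕ (shift c u) + X) % N ≡ toℕ v → (toℕ u + c + X) % N ≡ toℕ v
  shift-hits c u v X hit = begin
    (toℕ u + c + X) % N           ≡⟨ [m%n+k]%n≡[m+k]%n (toℕ u + c) X N ⟨
    ((toℕ u + c) % N + X) % N     ≡⟨ cong (λ i → (i + X) % N) (toℕ-shift c u) ⟨
    (toℕ (shift c u) + X) % N     ≡⟨ hit ⟩
    toℕ v                         ∎
    where open ≡-Reasoning

  reach⇒moves : ∀ L (u v : Fin N) → reach a L u v ≡ true → ∃₂ λ x y → x + y ≡ L × Moves u v x y
  reach⇒moves zero u v hit with u ≟ᶠ v
  ... | yes refl = 0 , 0 , refl , trans (cong (_% N) (+-identityʳ (toℕ u))) (m<n⇒m%n≡m (toℕ<n u))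
  reach⇒moves (suc L) u v hit with reach a L (shift 1 u) v in hit₁
  ... | true with reach⇒moves L (shift 1 u) v hit₁
  ...   | x , y , refl , moves = x , suc y , +-suc x y ,
            trans (cong (_% N) (short-step (toℕ u) x y a)) (shift-hits 1 u v _ moves)
    where
    short-step : ∀ i x y a → i + (x * a + suc y) ≡ i + 1 + (x * a + y)
    short-step = solve-∀
  reach⇒moves (suc L) u v hit | false with reach⇒moves L (shift a u) v hit
  ...   | x , y , refl , moves = suc x , y , refl ,
            trans (cong (_% N) (long-step (toℕ u) x y a)) (shift-hits a u v _ moves)
    where
    long-step : ∀ i x y a → i + (suc x * a + y) ≡ i + a + (x * a + y)
    long-step = solve-∀

  dist-≥-moves : ∀ (u v : Fin N) {m} → m ≤ N → (∀ x y → x + y < m → ¬ Moves u v x y) → m ≤ dist a u v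
  dist-≥-moves u v {m} m≤N miss =
    dist-≥ a u v m≤N (λ L L<m → ¬-not (λ hit → unreachable L<m (reach⇒moves L u v hit)))
    where
    unreachable : ∀ {L} → L < m → ¬ ∃₂ λ x y → x + y ≡ L × Moves u v x y
    unreachable L<m (x , y , refl , moves) = miss x y L<m moves

  independentBroadcast : (f : Fin N → ℕ) (m : ℕ) → m ≤ n′ → (∀ v → f v ≤ m) → (∀ v → m ≤ ecc a v) →
    (∀ u v → u ≢ v → 0 < f u → 0 < f v → ∀ x y → x + y ≤ f u → ¬ Moves u v x y) →
    IndependentBroadcast N a f
  independentBroadcast f m m≤n′ f≤m m≤ecc apart = record
    { le-diam = λ v → ≤-trans (f≤ecc v) (ecc≤diam a v)
    ; le-ecc  = f≤ecc
    ; indep   = λ u v u≢v 0<fu 0<fv → dist-≥-moves u v (s≤s (≤-trans (f≤m u) m≤n′))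
                  (λ x y → apart u v u≢v 0<fu 0<fv x y ∘ s≤s⁻¹)
    }
    where
    f≤ecc : ∀ v → f v ≤ ecc a v
    f≤ecc v = ≤-trans (f≤m v) (m≤ecc v)

moves≤ : ∀ x y a′ → x * suc a′ + y ≤ (x + y) * suc a′
moves≤ x y a′ = begin
  x * suc a′ + y          ≤⟨ +-monoʳ-≤ (x * suc a′) (m≤m*n y (suc a′)) ⟩
  x * suc a′ + y * suc a′ ≡⟨ *-distribʳ-+ (suc a′) x y ⟨
  (x + y) * suc a′        ∎
  where open ≤-Reasoning

-- The far vertex is v_{i-1} = shift n′ v_i: m steps advance the index by at most m·a < n′.
ecc-≥ : ∀ {n′} a′ (v : Fin (suc n′)) {m} → m * suc a′ < n′ → suc m ≤ ecc (suc a′) v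
ecc-≥ {n′} a′ v {m} ma<n′ =
  ≤-trans (dist-≥-moves a v (shift n′ v) (s≤s m≤n′) miss) (dist≤ecc a v (shift n′ v))
  where
  a = suc a′
  m≤n′ : m ≤ n′
  m≤n′ = <⇒≤ (≤-<-trans (m≤m*n m a) ma<n′)
  miss : ∀ x y → x + y < suc m → ¬ Moves a v (shift n′ v) x y
  miss x y x+y≤m moves =
    m<n<m+d⇒m%d≢n%d (suc n′) (+-monoʳ-< i X<n′) i+n′<i+X+N (trans moves (toℕ-shift a n′ v))
    where
    i = toℕ v
    X = x * a + y
    X<n′ : X < n′
    X<n′ = ≤-<-trans (≤-trans (moves≤ x y a′) (*-monoˡ-≤ a (s≤s⁻¹ x+y≤m))) ma<n′
    i+n′<i+X+N : i + n′ < i + X + suc n′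
    i+n′<i+X+N = subst (i + n′ <_) (sym (+-assoc i X (suc n′))) (+-monoʳ-< i (m≤n+m (suc n′) X))

module Levels (a′ q : ℕ) where
  a = suc a′

  level : ℕ → ℕ
  level i = i / a + i % a

  level-+*a : ∀ i m → level (i + m * a) ≡ m + level i
  level-+*a i m = begin
    (i + m * a) / a + (i + m * a) % a ≡⟨ cong₂ _+_ (+-distrib-/-∣ʳ i (divides-refl m)) ([m+kn]%n≡m%n i m a) ⟩
    i / a + m * a / a + i % a         ≡⟨ cong (λ k → i / a + k + i % a) (m*n/n≡m m a) ⟩
    i / a + m + i % a                 ≡⟨ cong (_+ i % a) (+-comm (i / a) m) ⟩
    m + i / a + i % a                 ≡⟨ +-assoc m (i / a) (i % a) ⟩
    m + level i                       ∎
    where open ≡-Reasoning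

  level-digits : ∀ c t → c < a → level (c + t * a) ≡ t + c
  level-digits c t c<a = cong₂ _+_ ([m+kn]/n≡k t a c<a) ([m+kn]%n≡m t a c<a)

  level≡0⇒≡0 : ∀ i → level i ≡ 0 → i ≡ 0
  level≡0⇒≡0 i level≡0 = begin
    i                 ≡⟨ m≡m%n+[m/n]*n i a ⟩
    i % a + i / a * a
      ≡⟨ cong₂ (λ c t → c + t * a) (m+n≡0⇒n≡0 (i / a) level≡0) (m+n≡0⇒m≡0 (i / a) level≡0) ⟩
    0                 ∎
    where open ≡-Reasoning

  level-carry : ∀ C T → C < a + a →
    T + C ≡ level (C + T * a) ⊎ (T + C ≡ level (C + T * a) + a′ × 0 < level (C + T * a))
  level-carry C T C<a+a with C <? a
  ... | yes C<a = inj₁ (sym (level-digits C T C<a))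
  ... | no C≮a  = inj₂ (T+C≡ , subst (0 <_) (sym level≡) z<s)
    where
    d = C ∸ a
    C≡a+d : C ≡ a + d
    C≡a+d = sym (m+[n∸m]≡n (≮⇒≥ C≮a))
    d<a : d < a
    d<a = +-cancelˡ-< a d a (subst (_< a + a) C≡a+d C<a+a)
    carry-out : ∀ a d T → a + d + T * a ≡ d + suc T * a
    carry-out = solve-∀
    level≡ : level (C + T * a) ≡ suc T + d
    level≡ = trans (cong (λ C → level (C + T * a)) C≡a+d)
                   (trans (cong level (carry-out a d T)) (level-digits d (suc T) d<a))
    regroup : ∀ T a′ d → T + (suc a′ + d) ≡ suc T + d + a′
    regroup = solve-∀
    T+C≡ : T + C ≡ level (C + T * a) + a′
    T+C≡ = trans (cong (T +_) C≡a+d) (trans (regroup T a′ d) (cong (_+ a′) (sym level≡)))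

  data LevelShift (L l l′ : ℕ) : Set where
    flat       : L + l ≡ l′ → LevelShift L l l′
    carry      : L + l ≡ l′ + a′ → 0 < l′ → LevelShift L l l′
    wrap       : L + l ≡ l′ + q → LevelShift L l l′
    wrap-carry : L + l ≡ l′ + (q + a′) → LevelShift L l l′

  LevelShift⇒≤ : ∀ {L l l′} → LevelShift L l l′ → l′ ≤ L + l
  LevelShift⇒≤           (flat e)       = ≤-reflexive (sym e)
  LevelShift⇒≤ {l′ = l′} (carry e _)    = subst (l′ ≤_) (sym e) (m≤m+n l′ a′)
  LevelShift⇒≤ {l′ = l′} (wrap e)       = subst (l′ ≤_) (sym e) (m≤m+n l′ q)
  LevelShift⇒≤ {l′ = l′} (wrap-carry e) = subst (l′ ≤_) (sym e) (m≤m+n l′ (q + a′))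

  level-shift : ∀ {n′} → suc n′ ≡ q * a + a′ → (u v : Fin (suc n′)) (x y : ℕ) → y < a →
    x * a + y < suc n′ → Moves a u v x y → LevelShift (x + y) (level (toℕ u)) (level (toℕ v))
  level-shift {n′} N≡ u v x y y<a X<N moves =
    shift-of (m<n+n⇒m≡m%n⊎m≡m%n+n (suc n′) (+-mono-< (toℕ<n u) X<N))
    where
    i = toℕ u
    l′ = level (toℕ v)
    p = i + (x * a + y)
    C = i % a + y
    T = i / a + x

    p≡C+Ta : p ≡ C + T * a
    p≡C+Ta = trans (cong (_+ (x * a + y)) (m≡m%n+[m/n]*n i a)) (regroup (i % a) (i / a) x y a)
      where
      regroup : ∀ c t x y a → c + t * a + (x * a + y) ≡ (c + y) + (t + x) * a
      regroup = solve-∀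

    T+C≡L+l : T + C ≡ x + y + level i
    T+C≡L+l = regroup (i / a) (i % a) x y
      where
      regroup : ∀ t c x y → (t + x) + (c + y) ≡ x + y + (t + c)
      regroup = solve-∀

    unwrapped : C + T * a ≡ toℕ v → LevelShift (x + y) (level i) l′
    unwrapped e with level-carry C T (+-mono-< (m%n<n i a) y<a)
    ... | inj₁ eq         = flat (trans (sym T+C≡L+l) (trans eq (cong level e)))
    ... | inj₂ (eq , 0<l) = carry (trans (sym T+C≡L+l) (trans eq (cong (λ j → level j + a′) e)))
                                  (subst (0 <_) (cong level e) 0<l)

    wrapped : suc C + T * a ≡ toℕ v + suc q * a → LevelShift (x + y) (level i) l′
    wrapped e = by-carry (level-carry (suc C) T (+-mono-≤-< (m%n<n i a) y<a))
      where
      open ≡-Reasoning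
      p′ = suc C + T * a
      level-p′ : level p′ ≡ suc q + l′
      level-p′ = trans (cong level e) (level-+*a (toℕ v) (suc q))
      1+L+l : suc (x + y + level i) ≡ T + suc C
      1+L+l = trans (cong suc (sym T+C≡L+l)) (sym (+-suc T C))
      regroup : ∀ q l a′ → q + l + a′ ≡ l + (q + a′)
      regroup = solve-∀

      by-carry : T + suc C ≡ level p′ ⊎ (T + suc C ≡ level p′ + a′ × 0 < level p′) →
                 LevelShift (x + y) (level i) l′
      by-carry (inj₁ eq) = wrap (suc-injective (begin
        suc (x + y + level i) ≡⟨ trans 1+L+l eq ⟩
        level p′              ≡⟨ level-p′ ⟩
        suc q + l′            ≡⟨ cong suc (+-comm q l′) ⟩
        suc (l′ + q)          ∎))
      by-carry (inj₂ (eq , _)) = wrap-carry (suc-injective (begin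
        suc (x + y + level i) ≡⟨ trans 1+L+l eq ⟩
        level p′ + a′         ≡⟨ cong (_+ a′) level-p′ ⟩
        suc q + l′ + a′       ≡⟨ cong suc (regroup q l′ a′) ⟩
        suc (l′ + (q + a′))   ∎))

    shift-of : p ≡ p % suc n′ ⊎ p ≡ p % suc n′ + suc n′ → LevelShift (x + y) (level i) l′
    shift-of (inj₁ p≡) = unwrapped (trans (sym p≡C+Ta) (trans p≡ moves))
    shift-of (inj₂ p≡) = wrapped (begin
      suc (C + T * a)               ≡⟨ cong suc (sym p≡C+Ta) ⟩
      suc p                         ≡⟨ cong suc (trans p≡ (cong (_+ suc n′) moves)) ⟩
      suc (toℕ v + suc n′)          ≡⟨ cong (λ N → suc (toℕ v + N)) N≡ ⟩
      suc (toℕ v + (q * a + a′))    ≡⟨ wrap-around (toℕ v) q a′ ⟩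
      toℕ v + suc q * a             ∎)
      where
      open ≡-Reasoning
      wrap-around : ∀ v q a′ → suc (v + (q * suc a′ + a′)) ≡ v + suc q * suc a′
      wrap-around = solve-∀

βb≥-mono : ∀ {n a b B} → b ≤ B → βb≥ n a B → βb≥ n a b
βb≥-mono b≤B (f , broadcast , B≤cost) = f , broadcast , ≤-trans b≤B B≤cost

module Construction (q₁ k₁ r s′ V₀ w : ℕ) where
  q = suc q₁
  k = suc k₁
  s = r + s′
  a′ = k * q + s

  open Levels a′ q

  q≤a′ : q ≤ a′
  q≤a′ = ≤-trans (m≤m+n q (k₁ * q)) (m≤m+n (k * q) s)

  q≤m*q : ∀ {m} → 1 ≤ m → q ≤ m * q
  q≤m*q {suc m} _ = m≤m+n q (m * q)

  profile : ℕ → ℕ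
  profile zero = 0
  profile (suc m) with m <? k
  ... | yes _ = q₁
  ... | no _ with m ≟ k
  ...   | yes _ = w
  ...   | no _  = 0

  weight : ℕ → ℕ
  weight l with l ≟ 0
  ... | yes _ = V₀
  ... | no _ with l % q ≟ r
  ...   | yes _ = profile (l / q)
  ...   | no _  = 0

  data Ray : ℕ → ℕ → Set where
    inner : ∀ {m} → 1 ≤ m → m ≤ k → Ray m q₁
    outer : Ray (suc k) w

  data Peak : ℕ → ℕ → Set where
    origin : Peak 0 V₀
    ray    : ∀ {m v} → Ray m v → Peak (r + m * q) v

  Ray⇒1≤m : ∀ {m v} → Ray m v → 1 ≤ m
  Ray⇒1≤m (inner 1≤m _) = 1≤m
  Ray⇒1≤m outer         = s≤s z≤n

  profile-inner : ∀ {m} → m < k → profile (suc m) ≡ q₁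
  profile-inner {m} m<k with m <? k
  ... | yes _  = refl
  ... | no m≮k = contradiction m<k m≮k

  profile-outer : profile (suc k) ≡ w
  profile-outer with k <? k
  ... | yes k<k = contradiction k<k (<-irrefl refl)
  ... | no _ with k ≟ k
  ...   | yes _  = refl
  ...   | no k≢k = contradiction refl k≢k

  profile-ray : ∀ m → 0 < profile m → Ray m (profile m)
  profile-ray (suc m) 0<p with m <? k
  ... | yes m<k = inner (s≤s z≤n) m<k
  ... | no _ with m ≟ k
  ...   | yes refl = outer
  profile-ray (suc m) () | no _ | no _

  module _ (s<q : s < q) where

    r<q : r < q
    r<q = ≤-<-trans (m≤m+n r s′) s<q

    weight-ray : ∀ m → 1 ≤ m → weight (r + m * q) ≡ profile m
    weight-ray m 1≤m with r + m * q ≟ 0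
    ... | yes l≡0 = contradiction l≡0 (m<n⇒n≢0 (<-≤-trans 1≤m (≤-trans (m≤m*n m q) (m≤n+m (m * q) r))))
    ... | no _ with (r + m * q) % q ≟ r
    ...   | yes _  = cong profile ([m+kn]/n≡k m q r<q)
    ...   | no r≢r = contradiction ([m+kn]%n≡m m q r<q) r≢r

    weight-peak : ∀ l → 0 < weight l → Peak l (weight l)
    weight-peak l 0<weight with l ≟ 0
    ... | yes refl = origin
    ... | no _ with l % q ≟ r
    ...   | yes l%q≡r = subst (λ z → Peak z (profile (l / q))) (sym l≡) (ray (profile-ray (l / q) 0<weight))
      where
      l≡ : l ≡ r + l / q * q
      l≡ = trans (m≡m%n+[m/n]*n l q) (cong (_+ l / q * q) l%q≡r)
    weight-peak l () | no _ | no _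

    row : ℕ → ℕ → ℕ
    row t len = ∑[ c < len ] weight (t + c)

    row-≥ : ∀ t j {len} → t ≤ r + q → r + suc j * q < t + len → ∑[ m < suc j ] profile (suc m) ≤ row t len
    row-≥ t j {len} t≤r+q end<t+len with m≤n⇒∃[o]m+o≡n t≤r+q
    ... | δ , t+δ≡r+q = begin
      ∑[ m < suc j ] profile (suc m)          ≡⟨ Σ<-cong (suc j) (λ m _ → sym (weight-at m)) ⟩
      ∑[ m < suc j ] weight (t + (δ + m * q)) ≤⟨ Σ<-window δ q₁ j (λ c → weight (t + c)) δ+jq<len ⟩
      row t len                               ∎
      where
      open ≤-Reasoning
      t+[δ+mq]≡ : ∀ m → t + (δ + m * q) ≡ r + suc m * q
      t+[δ+mq]≡ m = trans (sym (+-assoc t δ (m * q))) (trans (cong (_+ m * q) t+δ≡r+q) (+-assoc r q (m * q)))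
      weight-at : ∀ m → weight (t + (δ + m * q)) ≡ profile (suc m)
      weight-at m = trans (cong weight (t+[δ+mq]≡ m)) (weight-ray (suc m) (s≤s z≤n))
      δ+jq<len : δ + j * q < len
      δ+jq<len = +-cancelˡ-< t _ _ (subst (_< t + len) (sym (t+[δ+mq]≡ j)) end<t+len)

    inner-sum : k * q₁ ≤ ∑[ m < k ] profile (suc m)
    inner-sum = Σ<-const-≤ k (λ m m<k → ≤-reflexive (sym (profile-inner m<k)))

    row-inner : ∀ t {len} → t ≤ r + q → r + k * q < t + len → k * q₁ ≤ row t len
    row-inner t t≤r+q end<t+len = ≤-trans inner-sum (row-≥ t k₁ t≤r+q end<t+len)

    row-outer : ∀ t {len} → t ≤ r + q → r + suc k * q < t + len → k * q₁ + w ≤ row t len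
    row-outer t {len} t≤r+q end<t+len = begin
      k * q₁ + w                                   ≤⟨ +-monoˡ-≤ w inner-sum ⟩
      ∑[ m < k ] profile (suc m) + w               ≡⟨ cong (∑[ m < k ] profile (suc m) +_) profile-outer ⟨
      ∑[ m < k ] profile (suc m) + profile (suc k) ≡⟨ Σ<-suc k (profile ∘ suc) ⟨
      ∑[ m < suc k ] profile (suc m)               ≤⟨ row-≥ t k t≤r+q end<t+len ⟩
      row t len                                    ∎
      where open ≤-Reasoning

    cost-rows : Σ< (q * a + a′) (weight ∘ level) ≡ ∑[ t < q ] row t a + row q a′
    cost-rows = begin
      Σ< (q * a + a′) (weight ∘ level)                                     ≡⟨ Σ<-+ (q * a) a′ (weight ∘ level) ⟩
      Σ< (q * a) (weight ∘ level) + ∑[ c < a′ ] weight (level (q * a + c)) ≡⟨ cong₂ _+_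
        (trans (Σ<-blocks q a (weight ∘ level)) (Σ<-cong q (λ t _ → Σ<-cong a (weight-level t))))
        (Σ<-cong a′ (λ c c<a′ → weight-level q c (<-trans c<a′ ≤-refl))) ⟩
      ∑[ t < q ] row t a + row q a′                                        ∎
      where
      open ≡-Reasoning
      weight-level : ∀ t c → c < a → weight (level (t * a + c)) ≡ weight (t + c)
      weight-level t c c<a = cong weight (trans (cong level (+-comm (t * a) c)) (level-digits c t c<a))

    r+kq<a : r + k * q < a
    r+kq<a = s≤s (subst (_≤ a′) (+-comm (k * q) r) (+-monoʳ-≤ (k * q) (m≤m+n r s′)))

    outer-in-row : ∀ t → q ≤ t + s′ → r + suc k * q < t + a
    outer-in-row t q≤t+s′ = begin-strict
      r + (q + k * q)             ≤⟨ +-monoʳ-≤ r (+-monoˡ-≤ (k * q) q≤t+s′) ⟩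
      r + (t + s′ + k * q)        <⟨ n<1+n _ ⟩
      suc (r + (t + s′ + k * q))  ≡⟨ regroup r t s′ (k * q) ⟩
      t + a                       ∎
      where
      open ≤-Reasoning
      regroup : ∀ r t s′ x → suc (r + (t + s′ + x)) ≡ t + suc (x + (r + s′))
      regroup = solve-∀

    last-row-≥ : (0 < w → w < s′) → k * q₁ + w ≤ row q a′
    last-row-≥ w<s′ with 0 <? s′
    ... | yes 0<s′ = row-outer q (m≤n+m q r) (begin-strict
      r + (q + k * q)         <⟨ m<m+n _ 0<s′ ⟩
      r + (q + k * q) + s′    ≡⟨ regroup r q (k * q) s′ ⟩
      q + a′                  ∎)
      where
      open ≤-Reasoning
      regroup : ∀ r q x s′ → r + (q + x) + s′ ≡ q + (x + (r + s′))
      regroup = solve-∀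
    ... | no 0≮s′ = begin
      k * q₁ + w    ≡⟨ cong (k * q₁ +_) w≡0 ⟩
      k * q₁ + 0    ≡⟨ +-identityʳ (k * q₁) ⟩
      k * q₁        ≤⟨ row-inner q (m≤n+m q r) (<-≤-trans r+kq<a (+-monoˡ-≤ a′ (s≤s z≤n))) ⟩
      row q a′      ∎
      where
      open ≤-Reasoning
      w≡0 : w ≡ 0
      w≡0 = n≤0⇒n≡0 (≮⇒≥ (λ 0<w → 0≮s′ (≤-<-trans z≤n (w<s′ 0<w))))

    rows-≥ : (0 < w → w < s′) → ∀ e → e + s′ ≡ q₁ →
      V₀ + k * q₁ + (e * (k * q₁) + s′ * (k * q₁ + w)) + (k * q₁ + w) ≤ ∑[ t < q ] row t a + row q a′
    rows-≥ w<s′ e e+s′≡q₁ =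
      +-mono-≤ (+-mono-≤ (+-monoʳ-≤ V₀ (row-inner 1 (≤q⇒≤r+q (s≤s z≤n)) r+kq<a)) middle) (last-row-≥ w<s′)
      where
      open ≤-Reasoning
      ≤q⇒≤r+q : ∀ {t} → t ≤ q → t ≤ r + q
      ≤q⇒≤r+q t≤q = ≤-trans t≤q (m≤n+m q r)
      e≤q₁ : e ≤ q₁
      e≤q₁ = subst (e ≤_) e+s′≡q₁ (m≤m+n e s′)
      upper-row : ∀ i → i < e → k * q₁ ≤ row (suc i) a
      upper-row i i<e = row-inner (suc i) (≤q⇒≤r+q (s≤s (≤-trans (<⇒≤ i<e) e≤q₁)))
                          (<-≤-trans r+kq<a (m≤n+m a (suc i)))
      lower-row : ∀ j → j < s′ → k * q₁ + w ≤ row (suc (e + j)) a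
      lower-row j j<s′ =
        row-outer (suc (e + j)) (≤q⇒≤r+q (<⇒≤ (s≤s e+j<q₁))) (outer-in-row (suc (e + j)) q≤1+e+j+s′)
        where
        e+j<q₁ : e + j < q₁
        e+j<q₁ = subst (e + j <_) e+s′≡q₁ (+-monoʳ-< e j<s′)
        q≤1+e+j+s′ : q ≤ suc (e + j) + s′
        q≤1+e+j+s′ = s≤s (subst (_≤ e + j + s′) e+s′≡q₁ (+-monoˡ-≤ s′ (m≤m+n e j)))
      middle : e * (k * q₁) + s′ * (k * q₁ + w) ≤ ∑[ i < q₁ ] row (suc i) a
      middle = begin
        e * (k * q₁) + s′ * (k * q₁ + w)
          ≤⟨ +-mono-≤ (Σ<-const-≤ e upper-row) (Σ<-const-≤ s′ lower-row) ⟩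
        ∑[ i < e ] row (suc i) a + ∑[ j < s′ ] row (suc (e + j)) a
          ≡⟨ Σ<-+ e s′ (λ i → row (suc i) a) ⟨
        ∑[ i < e + s′ ] row (suc i) a
          ≡⟨ cong (λ n → ∑[ i < n ] row (suc i) a) e+s′≡q₁ ⟩
        ∑[ i < q₁ ] row (suc i) a
          ∎

    module _ (V₀≤q : V₀ ≤ q) (V₀<q+r : V₀ < q + r) (w≤q₁ : w ≤ q₁) (w<s′ : 0 < w → w < s′) where

      Ray⇒≤q₁ : ∀ {m v} → Ray m v → v ≤ q₁
      Ray⇒≤q₁ (inner _ _) = ≤-refl
      Ray⇒≤q₁ outer       = w≤q₁

      ray-shift : ∀ {L m v X} σ M → Ray m v → L ≤ v → σ < q →
        L + (r + m * q) ≡ X → X ≡ r + (σ + M * q) → L ≡ σ × m ≡ M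
      ray-shift {L} {m} σ M ρ L≤v σ<q e X≡ =
        m+kn≡o+ln⇒m≡o×k≡l m M q (s≤s (≤-trans L≤v (Ray⇒≤q₁ ρ))) σ<q
          (+-cancelˡ-≡ r _ _ (trans (swap L r (m * q)) (trans e X≡)))
        where
        swap : ∀ L r x → r + (L + x) ≡ L + (r + x)
        swap = solve-∀

      ray-no-return : ∀ {L m v X} M → Ray m v → 1 ≤ L → L ≤ v → L + (r + m * q) ≡ X → X ≢ r + M * q
      ray-no-return M ρ 1≤L L≤v e X≡ = m<n⇒n≢0 1≤L (proj₁ (ray-shift 0 M ρ L≤v z<s e X≡))

      -- A shift by σ ≥ s′ past the k-th ray point can only start on the outer ray, and its
      -- weight w < s′ is too small for that.
      ray-no-carry : ∀ {L m v X} σ M → Ray m v → 1 ≤ L → L ≤ v → s′ ≤ σ → σ < q → k < M →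
        L + (r + m * q) ≡ X → X ≢ r + (σ + M * q)
      ray-no-carry σ M ρ 1≤L L≤v s′≤σ σ<q k<M e X≡ with ray-shift σ M ρ L≤v σ<q e X≡ | ρ
      ... | refl , refl | inner _ m≤k = <⇒≱ k<M m≤k
      ... | refl , refl | outer       = <⇒≱ (w<s′ (≤-trans 1≤L L≤v)) (≤-trans s′≤σ L≤v)

      peaks-apart : ∀ {L l l′ v v′} → Peak l v → Peak l′ v′ → 1 ≤ L → L ≤ v →
        ¬ (l ≡ 0 × l′ ≡ 0) → ¬ LevelShift L l l′
      peaks-apart origin origin _ _ not-both _ = not-both (refl , refl)
      peaks-apart {L} origin (ray {m′} ρ′) _ L≤V₀ _ shift = <⇒≱ V₀<q+r (begin
        q + r           ≡⟨ +-comm q r ⟩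
        r + q           ≤⟨ +-monoʳ-≤ r (q≤m*q (Ray⇒1≤m ρ′)) ⟩
        r + m′ * q      ≤⟨ LevelShift⇒≤ shift ⟩
        L + 0           ≡⟨ +-identityʳ L ⟩
        L               ≤⟨ L≤V₀ ⟩
        V₀              ∎)
        where open ≤-Reasoning
      peaks-apart {L} (ray ρ) origin 1≤L _ _ (flat e) = m<n⇒n≢0 1≤L (m+n≡0⇒m≡0 L e)
      peaks-apart (ray ρ) origin _ _ _ (carry _ ())
      peaks-apart {L} (ray {m} ρ) origin 1≤L _ _ (wrap e) = <-irrefl (sym e) (begin-strict
        q               ≤⟨ q≤m*q (Ray⇒1≤m ρ) ⟩
        m * q           ≤⟨ m≤n+m (m * q) r ⟩
        r + m * q       <⟨ +-monoˡ-≤ (r + m * q) 1≤L ⟩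
        L + (r + m * q) ∎)
        where open ≤-Reasoning
      peaks-apart (ray ρ) origin 1≤L L≤v _ (wrap-carry e) =
        ray-no-carry s′ (suc k) ρ 1≤L L≤v ≤-refl (≤-<-trans (m≤n+m s′ r) s<q) ≤-refl e (regroup q k r s′)
        where
        regroup : ∀ q k r s′ → q + (k * q + (r + s′)) ≡ r + (s′ + suc k * q)
        regroup = solve-∀
      peaks-apart (ray ρ) (ray {m′} ρ′) 1≤L L≤v _ (flat e) = ray-no-return m′ ρ 1≤L L≤v e refl
      peaks-apart (ray ρ) (ray {m′} ρ′) 1≤L L≤v _ (carry e _) =
        ray-no-carry s (m′ + k) ρ 1≤L L≤v (m≤n+m s′ r) s<q (m<n+m k (Ray⇒1≤m ρ′))
          e (regroup r s′ k q m′)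
        where
        regroup : ∀ r s′ k q m′ → r + m′ * q + (k * q + (r + s′)) ≡ r + ((r + s′) + (m′ + k) * q)
        regroup = solve-∀
      peaks-apart (ray ρ) (ray {m′} ρ′) 1≤L L≤v _ (wrap e) =
        ray-no-return (suc m′) ρ 1≤L L≤v e (regroup r q m′)
        where
        regroup : ∀ r q m′ → r + m′ * q + q ≡ r + suc m′ * q
        regroup = solve-∀
      peaks-apart (ray ρ) (ray {m′} ρ′) 1≤L L≤v _ (wrap-carry e) =
        ray-no-carry s (suc m′ + k) ρ 1≤L L≤v (m≤n+m s′ r) s<q (m<n+m k z<s) e (regroup r s′ k q m′)
        where
        regroup : ∀ r s′ k q m′ → r + m′ * q + (q + (k * q + (r + s′))) ≡ r + ((r + s′) + (suc m′ + k) * q)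
        regroup = solve-∀

      Peak⇒≤q : ∀ {l v} → Peak l v → v ≤ q
      Peak⇒≤q origin  = V₀≤q
      Peak⇒≤q (ray ρ) = ≤-trans (Ray⇒≤q₁ ρ) (n≤1+n q₁)

      weight≤q : ∀ l → weight l ≤ q
      weight≤q l with 0 <? weight l
      ... | yes 0<weight = Peak⇒≤q (weight-peak l 0<weight)
      ... | no 0≮weight  = ≤-trans (≮⇒≥ 0≮weight) z≤n

      broadcast : Fin (q * a + a′) → ℕ
      broadcast v = weight (level (toℕ v))

      broadcast-moving-apart : ∀ u v → u ≢ v → 0 < broadcast u → 0 < broadcast v →
        ∀ x y → 1 ≤ x + y → x + y ≤ broadcast u → ¬ Moves a u v x y
      broadcast-moving-apart u v u≢v 0<fu 0<fv x y 1≤L L≤fu moves =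
        peaks-apart (weight-peak (level (toℕ u)) 0<fu) (weight-peak (level (toℕ v)) 0<fv) 1≤L L≤fu
          not-both (level-shift refl u v x y y<a X<N moves)
        where
        open ≤-Reasoning
        L≤q : x + y ≤ q
        L≤q = ≤-trans L≤fu (weight≤q (level (toℕ u)))
        y<a : y < a
        y<a = s≤s (≤-trans (m≤n+m y x) (≤-trans L≤q q≤a′))
        X<N : x * a + y < q * a + a′
        X<N = begin-strict
          x * a + y     ≤⟨ moves≤ x y a′ ⟩
          (x + y) * a   ≤⟨ *-monoˡ-≤ a L≤q ⟩
          q * a         <⟨ m<m+n (q * a) (<-≤-trans (s≤s z≤n) q≤a′) ⟩
          q * a + a′    ∎
        not-both : ¬ (level (toℕ u) ≡ 0 × level (toℕ v) ≡ 0)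
        not-both (u₀ , v₀) = u≢v (toℕ-injective (trans (level≡0⇒≡0 _ u₀) (sym (level≡0⇒≡0 _ v₀))))

      broadcast-apart : ∀ u v → u ≢ v → 0 < broadcast u → 0 < broadcast v →
        ∀ x y → x + y ≤ broadcast u → ¬ Moves a u v x y
      broadcast-apart u v u≢v _ _ zero zero _ moves = u≢v (toℕ-injective (begin
        toℕ u                       ≡⟨ m<n⇒m%n≡m (toℕ<n u) ⟨
        toℕ u % (q * a + a′)        ≡⟨ cong (_% (q * a + a′)) (+-identityʳ (toℕ u)) ⟨
        (toℕ u + 0) % (q * a + a′)  ≡⟨ moves ⟩
        toℕ v                       ∎))
        where open ≡-Reasoning
      broadcast-apart u v u≢v 0<fu 0<fv (suc x) y =
        broadcast-moving-apart u v u≢v 0<fu 0<fv (suc x) y (s≤s z≤n)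
      broadcast-apart u v u≢v 0<fu 0<fv zero (suc y) =
        broadcast-moving-apart u v u≢v 0<fu 0<fv zero (suc y) (s≤s z≤n)

      broadcast-independent : IndependentBroadcast (q * a + a′) a broadcast
      broadcast-independent = independentBroadcast a broadcast q q≤n′ (λ v → weight≤q (level (toℕ v)))
                                (λ v → ecc-≥ a′ v q₁a<n′) broadcast-apart
        where
        q≤n′ : q ≤ a′ + q₁ * a + a′
        q≤n′ = ≤-trans q≤a′ (≤-trans (m≤m+n a′ (q₁ * a)) (m≤m+n _ a′))
        q₁a<n′ : q₁ * a < a′ + q₁ * a + a′
        q₁a<n′ = <-≤-trans (m<n+m (q₁ * a) (<-≤-trans (s≤s z≤n) q≤a′)) (m≤m+n _ a′)

      broadcast-βb≥ : βb≥ (q * a + a′) a (V₀ + suc q * (k * q₁) + suc s′ * w)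
      broadcast-βb≥ with m≤n⇒∃[o]m+o≡n (s≤s⁻¹ (≤-<-trans (m≤n+m s′ r) s<q))
      ... | e , s′+e≡q₁ = broadcast , broadcast-independent , (begin
        V₀ + suc q * (k * q₁) + suc s′ * w
          ≡⟨ cong (λ z → V₀ + suc (suc z) * (k * q₁) + suc s′ * w) (sym s′+e≡q₁) ⟩
        V₀ + suc (suc (s′ + e)) * (k * q₁) + suc s′ * w
          ≡⟨ regroup V₀ (k * q₁) e s′ w ⟩
        V₀ + k * q₁ + (e * (k * q₁) + s′ * (k * q₁ + w)) + (k * q₁ + w)
          ≤⟨ rows-≥ w<s′ e (trans (+-comm e s′) s′+e≡q₁) ⟩
        ∑[ t < q ] row t a + row q a′
          ≡⟨ trans (cost-toℕ (q * a + a′) (weight ∘ level)) cost-rows ⟨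
        cost broadcast
          ∎)
        where
        open ≤-Reasoning
        regroup : ∀ V₀ x e s′ w →
          V₀ + suc (suc (s′ + e)) * x + suc s′ * w ≡ V₀ + x + (e * x + s′ * (x + w)) + (x + w)
        regroup = solve-∀

      circulant-βb≥ : ∀ {n a₀ b} → n ≡ q * a₀ + a₀ ∸ 1 → a₀ ≡ k * q + 1 + s →
        b ≤ V₀ + suc q * (k * q₁) + suc s′ * w → βb≥ n a₀ b
      circulant-βb≥ {b = b} refl a₀≡ b≤ with trans a₀≡ (trans (+-assoc (k * q) 1 s) (+-suc (k * q) s))
      ... | refl = subst (λ n → βb≥ n a b) (sym (+-∸-assoc (q * a) (s≤s z≤n))) (βb≥-mono b≤ broadcast-βb≥)

bound-s≡0 : ∀ k₁ q₁ → let k = suc k₁; q = suc q₁ in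
  (k * q + 1 + 0 + k) * q₁ ≡ q₁ + suc q * (k * q₁) + 1 * 0
bound-s≡0 = solve-∀

bound-s≡1 : ∀ k₁ q₁ → let k = suc k₁; q = suc q₁ in
  (k * q + 1 + 1 + k ∸ 1) * q₁ + 1 ≡ q + suc q * (k * q₁) + 1 * 0
bound-s≡1 k₁ q₁ = reduced k₁ q₁
  where
  -- k * q is a successor by definition, so the ∸ 1 computes away.
  reduced : ∀ k₁ q₁ → (q₁ + k₁ * suc q₁ + 1 + 1 + suc k₁) * q₁ + 1
                    ≡ suc q₁ + suc (suc q₁) * (suc k₁ * q₁) + 1 * 0
  reduced = solve-∀

bound-2≤s : ∀ k₁ q₁ s₂ → let k = suc k₁; q = suc q₁; s = suc (suc s₂) in
  (k * q + 1 + s + k ∸ s) * q₁ + (s ∸ 1) * (s + 1) ≡ q₁ + suc q * (k * q₁) + suc s * (s ∸ 1)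
bound-2≤s k₁ q₁ s₂ = begin
  (k * q + 1 + s + k ∸ s) * q₁ + suc s₂ * (s + 1)
    ≡⟨ cong (λ z → (z ∸ s) * q₁ + suc s₂ * (s + 1)) (swap (k * q) s k) ⟩
  (k * q + 1 + k + s ∸ s) * q₁ + suc s₂ * (s + 1)
    ≡⟨ cong (λ z → z * q₁ + suc s₂ * (s + 1)) (m+n∸n≡m (k * q + 1 + k) s) ⟩
  (k * q + 1 + k) * q₁ + suc s₂ * (s + 1)
    ≡⟨ regroup k₁ q₁ s₂ ⟩
  q₁ + suc q * (k * q₁) + suc s * suc s₂
    ∎
  where
  open ≡-Reasoning
  k = suc k₁
  q = suc q₁
  s = suc (suc s₂)
  swap : ∀ x s k → x + 1 + s + k ≡ x + 1 + k + s
  swap = solve-∀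
  regroup : ∀ k₁ q₁ s₂ → (suc k₁ * suc q₁ + 1 + suc k₁) * q₁ + suc s₂ * (suc (suc s₂) + 1)
                       ≡ q₁ + suc (suc q₁) * (suc k₁ * q₁) + suc (suc (suc s₂)) * suc s₂
  regroup = solve-∀

proposition24 : (n a q k s : ℕ) → n ≡ q * a + a ∸ 1 → 3 ≤ q → q < a ∸ 1
    → a ≡ k * q + 1 + s → 1 ≤ k → s ≤ q ∸ 1
    → (s ≡ 0 → βb≥ n a ((a + k) * (q ∸ 1)))
    × (s ≡ 1 → βb≥ n a ((a + k ∸ 1) * (q ∸ 1) + 1))
    × (2 ≤ s → βb≥ n a ((a + k ∸ s) * (q ∸ 1) + (s ∸ 1) * (s + 1)))
proposition24 n _ (suc q₁) (suc k₁) s n≡ (s≤s 2≤q₁) _ refl (s≤s z≤n) s≤q₁ =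
    (λ { refl → circulant-βb≥ 0 0 q₁ 0
                  z<s (n≤1+n q₁) (s≤s (m≤m+n q₁ 0)) z≤n (λ ()) n≡ refl (≤-reflexive (bound-s≡0 k₁ q₁)) })
  , (λ { refl → circulant-βb≥ 1 0 (suc q₁) 0
                  (s≤s (≤-trans (s≤s z≤n) 2≤q₁)) ≤-refl (m<m+n (suc q₁) z<s) z≤n (λ ()) n≡ refl
                  (≤-reflexive (bound-s≡1 k₁ q₁)) })
  , λ { (s≤s (s≤s {n = s₂} _)) → circulant-βb≥ 0 s q₁ (suc s₂)
                  (s≤s s≤q₁) (n≤1+n q₁) (s≤s (m≤m+n q₁ 0)) (≤-trans (n≤1+n (suc s₂)) s≤q₁)
                  (λ _ → ≤-refl) n≡ refl (≤-reflexive (bound-2≤s k₁ q₁ s₂)) }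
  where
  open Construction q₁ k₁ using (circulant-βb≥)
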